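{- Let $k\ge 1$ and $0\le t\le k$ be integers and let $n\ge 1$. Then \[ [x^n]\,\partial_u^2 S_{t,0}(x,u)\big|_{u=1}=\frac{2(t-2k-1)}{n+2}\binom{(k+1)n+t}{n+1}+\frac{2(t-1)k}{n+1}\binom{(k+1)n}{n}+\frac{4k}{n+2}\binom{(k+1)n+1}{n+1}. \]
   Context: A $k_t$-Dyck path is a lattice path consisting of up-steps $(1,k)$ and down-steps $(1,-1)$ that starts at $(0,0)$, stays weakly above the line $y=-t$, and ends on the line $y=0$. $S_{t,0}(x,u)=\sum_P x^{\mathrm{up}(P)}u^{b(P)}$, summed over all $k_t$-Dyck paths $P$, where $\mathrm{up}(P)$ is the number of up-steps and $b(P)$ the number of down-steps before the first up-step of $P$ ($b=0$ for the empty path). $[x^n]$ denotes coefficient extraction. -}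

module Defs where

open import Data.Nat as ℕ using (ℕ; zero; suc)
open import Data.Integer as ℤ using (ℤ; +_; -_)
open import Data.Bool using (Bool; true; false; _∧_)
open import Data.List using (List; []; _∷_; map; concatMap; filter; length)
open import Data.Nat.ListAction using (sum)
open import Relation.Nullary.Decidable using (⌊_⌋)
open import Relation.Binary.PropositionalEquality using (_≡_)
open import Data.Nat.Combinatorics using (_C_)
open import Data.Rational as ℚ using (ℚ; _/_)

-- Steps of a k_t-Dyck path: up-step (1,k) and down-step (1,-1).
data Step : Set where
  U D : Step

allWords : ℕ → List (List Step)
allWords zero    = [] ∷ []
allWords (suc L) = concatMap (λ w → (U ∷ w) ∷ (D ∷ w) ∷ []) (allWords L)

validFrom : ℕ → ℕ → ℤ → List Step → Bool
validFrom k t h []       = ⌊ h ℤ.≟ + 0 ⌋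
validFrom k t h (U ∷ w)  = ⌊ - (+ t) ℤ.≤? (h ℤ.+ + k) ⌋ ∧ validFrom k t (h ℤ.+ + k) w
validFrom k t h (D ∷ w)  = ⌊ - (+ t) ℤ.≤? (h ℤ.- + 1) ⌋ ∧ validFrom k t (h ℤ.- + 1) w

isKtDyck : ℕ → ℕ → List Step → Bool
isKtDyck k t w = validFrom k t (+ 0) w

ups : List Step → ℕ
ups []      = 0
ups (U ∷ w) = suc (ups w)
ups (D ∷ w) = ups w

initDowns : List Step → ℕ
initDowns []      = 0
initDowns (U ∷ w) = 0
initDowns (D ∷ w) = suc (initDowns w)

-- Such a path has n up-steps
-- and (since it ends at height 0) exactly k*n down-steps, hence length (k+1)*n;
-- so enumerating words of that length and filtering is exhaustive.
ktDyckPaths : ℕ → ℕ → ℕ → List (List Step)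
ktDyckPaths k t n =
  filter (λ w → Data.Bool.T? (isKtDyck k t w ∧ ⌊ ups w ℕ.≟ n ⌋))
         (allWords (suc k ℕ.* n))
  where import Data.Bool

-- [x^u] S_{t,0}(x,u) is the polynomial Σ_P u^{b(P)} over paths with n up-steps;
-- its second u-derivative at u = 1 is Σ_P b(P)(b(P)-1).
coeffD2S : ℕ → ℕ → ℕ → ℕ
coeffD2S k t n = sum (map (λ P → initDowns P ℕ.* (initDowns P ℕ.∸ 1)) (ktDyckPaths k t n))

rhs : ℕ → ℕ → ℕ → ℚ
rhs k t n =
      ((+ 2 ℤ.* (+ t ℤ.- + (2 ℕ.* k) ℤ.- + 1)) / suc (suc n)) ℚ.* ((+ ((suc k ℕ.* n ℕ.+ t) C (n ℕ.+ 1))) / 1)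
  ℚ.+ ((+ 2 ℤ.* (+ t ℤ.- + 1) ℤ.* + k) / suc n) ℚ.* ((+ ((suc k ℕ.* n) C n)) / 1)
  ℚ.+ ((+ (4 ℕ.* k)) / suc (suc n)) ℚ.* ((+ ((suc k ℕ.* n ℕ.+ 1) C (n ℕ.+ 1))) / 1)

module Submission where

open import Defs
open import Data.Nat using (ℕ; _≤_)
open import Data.Integer using (+_)
open import Data.Rational using (ℚ; _/_)
open import Relation.Binary.PropositionalEquality using (_≡_)

-- Write n = m+1 and measure heights from the floor y = -t.  A k_t-Dyck path whose
-- first up-step is preceded by b down-steps is D^b U followed by a path from distance
-- t-b+k above the floor to the axis y = 0 (distance t) that never goes below the floor.
-- Walks from distance d to the axis with n up-steps are counted by the Raney number
-- R (d+1) n, with closed form (r + (k+1)n) R r n = r C(r+(k+1)n, n).  So the coefficient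
-- is Σ_{b ≤ t} b(b-1) R (t-b+k+1) m, which regroups as the iterated tail sum Σ₂ m t of the
-- sums Σ₁ m d = R 1 n + … + R d n.  Pascal's rule and absorption give closed forms for Σ₁
-- and Σ₂ by induction on d, and the theorem is the closed form of Σ₂ at d = t, read in ℚ.

module WordSums where
  open import Data.Nat using (suc; _+_; _*_)
  open import Data.Nat.Properties using (+-assoc; *-zeroʳ; *-distribˡ-+; *-identityʳ)
  open import Data.Bool using (Bool; true; false; T?)
  open import Data.List using (List; []; _∷_; map; filter; concatMap)
  open import Data.List.Properties using (map-cong)
  open import Data.Nat.ListAction using (sum)
  open import Relation.Binary.PropositionalEquality using (refl; sym; trans; cong)
  open import Data.Nat.Tactic.RingSolver using (solve-∀)

  when : Bool → ℕ → ℕ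
  when true  x = x
  when false x = 0

  when-scale : ∀ b x → when b x ≡ x * when b 1
  when-scale true  x = sym (*-identityʳ x)
  when-scale false x = sym (*-zeroʳ x)

  module _ {A : Set} where

    sum-map-+ : (φ ψ : A → ℕ) (xs : List A) →
      sum (map (λ x → φ x + ψ x) xs) ≡ sum (map φ xs) + sum (map ψ xs)
    sum-map-+ φ ψ [] = refl
    sum-map-+ φ ψ (x ∷ xs) =
      trans (cong (_+_ (φ x + ψ x)) (sum-map-+ φ ψ xs)) (interchange (φ x) (ψ x) _ _)
      where
      interchange : ∀ a b c d → a + b + (c + d) ≡ a + c + (b + d)
      interchange = solve-∀

    sum-map-* : (c : ℕ) (φ : A → ℕ) (xs : List A) →
      sum (map (λ x → c * φ x) xs) ≡ c * sum (map φ xs)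
    sum-map-* c φ [] = sym (*-zeroʳ c)
    sum-map-* c φ (x ∷ xs) =
      trans (cong (_+_ (c * φ x)) (sum-map-* c φ xs)) (sym (*-distribˡ-+ c (φ x) _))

    sum-filter : (b : A → Bool) (φ : A → ℕ) (xs : List A) →
      sum (map φ (filter (λ x → T? (b x)) xs)) ≡ sum (map (λ x → when (b x) (φ x)) xs)
    sum-filter b φ [] = refl
    sum-filter b φ (x ∷ xs) with b x
    ... | true  = cong (_+_ (φ x)) (sum-filter b φ xs)
    ... | false = sum-filter b φ xs

  Σwords : ℕ → (List Step → ℕ) → ℕ
  Σwords L φ = sum (map φ (allWords L))

  Σwords-cong : ∀ L {φ ψ} → (∀ w → φ w ≡ ψ w) → Σwords L φ ≡ Σwords L ψ
  Σwords-cong L e = cong sum (map-cong e (allWords L))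

  Σwords-+ : ∀ L φ ψ → Σwords L (λ w → φ w + ψ w) ≡ Σwords L φ + Σwords L ψ
  Σwords-+ L φ ψ = sum-map-+ φ ψ (allWords L)

  Σwords-* : ∀ L c φ → Σwords L (λ w → c * φ w) ≡ c * Σwords L φ
  Σwords-* L c φ = sum-map-* c φ (allWords L)

  Σwords-suc : ∀ L φ → Σwords (suc L) φ ≡ Σwords L (λ w → φ (U ∷ w) + φ (D ∷ w))
  Σwords-suc L φ = firstLetter (allWords L)
    where
    firstLetter : (ws : List (List Step)) →
      sum (map φ (concatMap (λ w → (U ∷ w) ∷ (D ∷ w) ∷ []) ws))
        ≡ sum (map (λ w → φ (U ∷ w) + φ (D ∷ w)) ws)
    firstLetter [] = refl
    firstLetter (w ∷ ws) =
      trans (sym (+-assoc (φ (U ∷ w)) (φ (D ∷ w)) _)) (cong (_+_ (φ (U ∷ w) + φ (D ∷ w))) (firstLetter ws))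

module FloorWalks (k t : ℕ) where
  open import Data.Nat using (zero; suc; _+_; z≤n)
  open import Data.Nat.Properties as ℕP using (suc-injective)
  open import Data.Integer as ℤ using (ℤ; -_; -[1+_])
  import Data.Integer.Properties as ℤP
  open import Data.Bool using (Bool; true; false; _∧_)
  open import Data.Bool.Properties using (∧-zeroʳ)
  open import Data.List using (List; []; _∷_)
  open import Function.Bundles using (mk⇔)
  open import Relation.Nullary using (¬_; Dec)
  open import Relation.Nullary.Decidable using (⌊_⌋; isYes≗does; dec-true; dec-false; does-⇔)
  open import Relation.Binary.PropositionalEquality using (refl; sym; trans; cong; subst)
  open import Data.Integer.Tactic.RingSolver using (solve-∀)

  module _ {A : Set} where
    ⌊⌋-true : (a? : Dec A) → A → ⌊ a? ⌋ ≡ true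
    ⌊⌋-true a? a = trans (isYes≗does a?) (dec-true a? a)

    ⌊⌋-false : (a? : Dec A) → ¬ A → ⌊ a? ⌋ ≡ false
    ⌊⌋-false a? ¬a = trans (isYes≗does a?) (dec-false a? ¬a)

    ⌊⌋-cong : {B : Set} → (A → B) → (B → A) → (a? : Dec A) (b? : Dec B) → ⌊ a? ⌋ ≡ ⌊ b? ⌋
    ⌊⌋-cong to from a? b? =
      trans (isYes≗does a?) (trans (does-⇔ (mk⇔ to from) a? b?) (sym (isYes≗does b?)))

  height : ℕ → ℤ
  height d = + d ℤ.- + t

  reachesAxis : List Step → ℕ → ℕ → Bool
  reachesAxis []      d       n       = ⌊ d ℕP.≟ t ⌋ ∧ ⌊ 0 ℕP.≟ n ⌋
  reachesAxis (U ∷ w) d       zero    = false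
  reachesAxis (U ∷ w) d       (suc n) = reachesAxis w (d + k) n
  reachesAxis (D ∷ w) zero    n       = false
  reachesAxis (D ∷ w) (suc d) n       = reachesAxis w d n

  aboveFloor : ∀ d → - (+ t) ℤ.≤ height d
  aboveFloor d = subst (ℤ._≤ height d) (ℤP.+-identityˡ (- + t)) (ℤP.+-monoˡ-≤ (- + t) (ℤ.+≤+ z≤n))

  upStep : ∀ d → height d ℤ.+ + k ≡ height (d + k)
  upStep d = shift (+ d) (+ t) (+ k)
    where
    shift : ∀ a b c → a ℤ.- b ℤ.+ c ≡ (a ℤ.+ c) ℤ.- b
    shift = solve-∀

  downStep : ∀ d → height (suc d) ℤ.- + 1 ≡ height d
  downStep d = shift (+ d) (+ t)
    where
    shift : ∀ a b → (+ 1 ℤ.+ a) ℤ.- b ℤ.- + 1 ≡ a ℤ.- b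
    shift = solve-∀

  belowFloor : ¬ (- (+ t) ℤ.≤ height 0 ℤ.- + 1)
  belowFloor below = ℤP.<⇒≱ (ℤP.neg-mono-< (ℤ.+<+ (ℕP.n<1+n t))) (subst (- (+ t) ℤ.≤_) oneBelow below)
    where
    oneBelow : height 0 ℤ.- + 1 ≡ -[1+ t ]
    oneBelow = shift (+ t)
      where
      shift : ∀ b → + 0 ℤ.- b ℤ.- + 1 ≡ - (+ 1 ℤ.+ b)
      shift = solve-∀

  onAxis : ∀ d → ⌊ height d ℤ.≟ + 0 ⌋ ≡ ⌊ d ℕP.≟ t ⌋
  onAxis d = ⌊⌋-cong (λ e → ℤP.+-injective (ℤP.i-j≡0⇒i≡j (+ d) (+ t) e))
                     (λ { refl → ℤP.+-inverseʳ (+ d) }) _ _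

  validFrom-reachesAxis : ∀ w d n →
    (validFrom k t (height d) w ∧ ⌊ ups w ℕP.≟ n ⌋) ≡ reachesAxis w d n
  validFrom-reachesAxis [] d n = cong (_∧ ⌊ 0 ℕP.≟ n ⌋) (onAxis d)
  validFrom-reachesAxis (U ∷ w) d n
    rewrite upStep d | ⌊⌋-true (- (+ t) ℤ.≤? height (d + k)) (aboveFloor (d + k)) = afterUp n
    where
    afterUp : ∀ n → (validFrom k t (height (d + k)) w ∧ ⌊ suc (ups w) ℕP.≟ n ⌋) ≡ reachesAxis (U ∷ w) d n
    afterUp zero    = ∧-zeroʳ _
    afterUp (suc n) =
      trans (cong (validFrom k t (height (d + k)) w ∧_) (⌊⌋-cong suc-injective (cong suc) _ _))
            (validFrom-reachesAxis w (d + k) n)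
  validFrom-reachesAxis (D ∷ w) zero n
    rewrite ⌊⌋-false (- (+ t) ℤ.≤? (height 0 ℤ.- + 1)) belowFloor = refl
  validFrom-reachesAxis (D ∷ w) (suc d) n
    rewrite downStep d | ⌊⌋-true (- (+ t) ℤ.≤? height d) (aboveFloor d) = validFrom-reachesAxis w d n

module Binomial where
  open import Data.Nat using (zero; suc; _+_; _*_; z≤n; s≤s)
  open import Data.Nat.Properties using (*-zeroʳ; *-comm)
  open import Data.Nat.Combinatorics using (_C_; nCk+nC[k+1]≡[n+1]C[k+1]; nC1≡n; k>n⇒nCk≡0)
  open import Relation.Binary.PropositionalEquality using (refl; sym; cong; cong₂; module ≡-Reasoning)
  open import Data.Nat.Tactic.RingSolver using (solve-∀)

  pascal : ∀ n j → suc n C suc j ≡ n C j + n C suc j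
  pascal n j = sym (nCk+nC[k+1]≡[n+1]C[k+1] n j)

  absorption : ∀ n j → suc j * (suc n C suc j) ≡ suc n * (n C j)
  absorption zero    zero    = refl
  absorption zero    (suc j)
    rewrite k>n⇒nCk≡0 {1} {suc (suc j)} (s≤s (s≤s z≤n)) | k>n⇒nCk≡0 {0} {suc j} (s≤s z≤n) = *-zeroʳ (suc (suc j))
  absorption (suc n) zero rewrite nC1≡n (suc (suc n)) = *-comm 1 (suc (suc n))
  absorption (suc n) (suc j) = begin
      suc (suc j) * (suc (suc n) C suc (suc j))
    ≡⟨ cong (suc (suc j) *_) (pascal (suc n) (suc j)) ⟩
      suc (suc j) * (suc n C suc j + suc n C suc (suc j))
    ≡⟨ split j (suc n C suc j) (suc n C suc (suc j)) ⟩
      suc j * (suc n C suc j) + (suc n C suc j) + suc (suc j) * (suc n C suc (suc j))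
    ≡⟨ cong₂ (λ a b → a + (suc n C suc j) + b) (absorption n j) (absorption n (suc j)) ⟩
      suc n * (n C j) + (suc n C suc j) + suc n * (n C suc j)
    ≡⟨ regroup n (n C j) (n C suc j) (suc n C suc j) ⟩
      suc n * (n C j + n C suc j) + (suc n C suc j)
    ≡⟨ cong (λ z → suc n * z + (suc n C suc j)) (sym (pascal n j)) ⟩
      suc n * (suc n C suc j) + (suc n C suc j)
    ≡⟨ collect n (suc n C suc j) ⟩
      suc (suc n) * (suc n C suc j)
    ∎
    where
    open ≡-Reasoning
    split : ∀ j a b → suc (suc j) * (a + b) ≡ suc j * a + a + suc (suc j) * b
    split = solve-∀
    regroup : ∀ n a b c → suc n * a + c + suc n * b ≡ suc n * (a + b) + c
    regroup = solve-∀
    collect : ∀ n a → suc n * a + a ≡ suc (suc n) * a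
    collect = solve-∀

module RaneyNumbers (k : ℕ) where
  open import Data.Nat using (zero; suc; _+_; _*_)
  open import Data.Nat.Properties using (*-zeroʳ; +-identityʳ; +-suc; *-cancelˡ-≡; +-cancelʳ-≡)
  open import Data.Nat.Combinatorics using (_C_)
  open import Relation.Binary.PropositionalEquality using (refl; sym; trans; cong; cong₂; subst; module ≡-Reasoning)
  open import Data.Nat.Tactic.RingSolver using (solve-∀)
  open Binomial

  -- The Raney numbers R r n, by the first-step recursion of walks with up-steps +k and
  -- down-steps -1 that start at distance r-1 above a floor and end on it after n up-steps.
  R : ℕ → ℕ → ℕ
  R zero    zero    = 1
  R zero    (suc n) = 0
  R (suc r) zero    = 1
  R (suc r) (suc n) = R r (suc n) + R (suc r + k) n

  Σ₁ : ℕ → ℕ → ℕ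
  Σ₁ m zero    = 0
  Σ₁ m (suc d) = Σ₁ m d + R (suc d) (suc m)

  Σ₂ : ℕ → ℕ → ℕ
  Σ₂ m zero    = 0
  Σ₂ m (suc d) = Σ₂ m d + 2 * Σ₁ m d

  -- One step of the closed form: the two recursive terms, combined with Pascal's rule
  -- and absorption, give the closed form for R (r+1) (n+1), after cancelling the
  -- nonzero factor M = r + (k+1)(n+1).
  raney-step : ∀ r n →
    (r + suc k * suc n) * R r (suc n) ≡ r * ((r + suc k * suc n) C suc n) →
    (suc r + k + suc k * n) * R (suc r + k) n ≡ (suc r + k) * ((suc r + k + suc k * n) C n) →
    (suc r + suc k * suc n) * R (suc r) (suc n) ≡ suc r * ((suc r + suc k * suc n) C suc n)
  raney-step r n ih-down ih-up = cancelM (begin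
      M * (suc M * (R₁ + R₂))
    ≡⟨ distribute M R₁ R₂ ⟩
      suc M * (M * R₁) + suc M * (M * R₂)
    ≡⟨ cong₂ (λ a b → suc M * a + suc M * b) ih-down ih-up′ ⟩
      suc M * (r * X) + suc M * ((suc r + k) * Y)
    ≡⟨ sym combined ⟩
      M * (suc r * (Y + X))
    ≡⟨ cong (λ z → M * (suc r * z)) (sym (pascal M n)) ⟩
      M * (suc r * (suc M C suc n))
    ∎)
    where
    open ≡-Reasoning
    M = r + suc k * suc n
    X = M C suc n
    Y = M C n
    R₁ = R r (suc n)
    R₂ = R (suc r + k) n
    ih-up′ : M * R₂ ≡ (suc r + k) * Y
    ih-up′ = subst (λ z → z * R₂ ≡ (suc r + k) * (z C n)) (sameTop k r n) ih-up
      where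
      sameTop : ∀ k r n → suc r + k + suc k * n ≡ r + suc k * suc n
      sameTop = solve-∀
    absorbed : suc n * (Y + X) ≡ suc M * Y
    absorbed = trans (cong (suc n *_) (sym (pascal M n))) (absorption M n)
    combined : M * (suc r * (Y + X)) ≡ suc M * (r * X) + suc M * ((suc r + k) * Y)
    combined = +-cancelʳ-≡ _ _ _ (trans (identity r k n X Y)
      (cong (λ z → suc M * (r * X) + suc M * ((suc r + k) * Y) + suc k * z) absorbed))
      where
      identity : ∀ r k n X Y →
        (r + suc k * suc n) * (suc r * (Y + X)) + suc k * (suc (r + suc k * suc n) * Y)
          ≡ suc (r + suc k * suc n) * (r * X) + suc (r + suc k * suc n) * ((suc r + k) * Y)
            + suc k * (suc n * (Y + X))
      identity = solve-∀
    distribute : ∀ M a b → M * (suc M * (a + b)) ≡ suc M * (M * a) + suc M * (M * b)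
    distribute = solve-∀
    cancelM : ∀ {a b} → M * a ≡ M * b → a ≡ b
    cancelM {a} {b} e = *-cancelˡ-≡ a b (suc (r + (n + k * suc n)))
      (subst (λ z → z * a ≡ z * b) (+-suc r (n + k * suc n)) e)

  raney : ∀ r n → (r + suc k * n) * R r n ≡ r * ((r + suc k * n) C n)
  raney zero    zero    rewrite *-zeroʳ k = refl
  raney zero    (suc n) = *-zeroʳ (suc k * suc n)
  raney (suc r) zero    rewrite *-zeroʳ k | +-identityʳ r = refl
  raney (suc r) (suc n) = raney-step r n (raney r (suc n)) (raney (suc r + k) n)

module Counting (k t : ℕ) (t≤k : t ≤ k) where
  open import Data.Nat using (zero; suc; _+_; _*_; _∸_; _<_)
  open import Data.Nat.Properties as ℕP using (+-identityʳ; +-suc; suc-injective)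
  import Data.Integer.Properties as ℤP
  open import Data.Bool using (_∧_)
  open import Data.Empty using (⊥-elim)
  open import Relation.Nullary.Decidable using (⌊_⌋)
  open import Relation.Binary.PropositionalEquality using (_≢_; refl; sym; trans; cong; cong₂; subst; module ≡-Reasoning)
  open import Data.Nat.Tactic.RingSolver using (solve-∀)
  open WordSums
  open FloorWalks k t
  open RaneyNumbers k

  count : ℕ → ℕ → ℕ → ℕ
  count L d n = Σwords L (λ w → when (reachesAxis w d n) 1)

  -- The length bookkeeping L + t = (k+1)n + d fails for the empty word once n ≥ 1,
  -- because the axis is at distance t ≤ k above the floor.
  emptyWord-noUps : ∀ n d → t ≢ suc k * suc n + d
  emptyWord-noUps n d e = ℕP.<-irrefl refl (ℕP.<-≤-trans k<t t≤k)
    where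
    unfold : ∀ k n d → suc k + (suc k * n + d) ≡ suc k * suc n + d
    unfold = solve-∀
    k<t : k < t
    k<t = subst (suc k ≤_) (trans (unfold k n d) (sym e)) (ℕP.m≤m+n (suc k) (suc k * n + d))

  afterUp-length : ∀ L n d → suc L + t ≡ suc k * suc n + d → L + t ≡ suc k * n + (d + k)
  afterUp-length L n d e = suc-injective (trans e (unfold k n d))
    where
    unfold : ∀ k n d → suc k * suc n + d ≡ suc (suc k * n + (d + k))
    unfold = solve-∀

  afterDown-length : ∀ L n d → suc L + t ≡ suc k * n + suc d → L + t ≡ suc k * n + d
  afterDown-length L n d e = suc-injective (trans e (+-suc (suc k * n) d))

  count-raney : ∀ L d n → L + t ≡ suc k * n + d → count L d n ≡ R (suc d) n
  count-raney zero d zero e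
    rewrite ⌊⌋-true (d ℕP.≟ t) (sym (trans e (cong (_+ d) (ℕP.*-zeroʳ (suc k))))) = refl
  count-raney zero d (suc n) e = ⊥-elim (emptyWord-noUps n d e)
  count-raney (suc L) zero zero e =
    ⊥-elim (ℕP.1+n≢0 (trans e (trans (+-identityʳ _) (ℕP.*-zeroʳ (suc k)))))
  count-raney (suc L) (suc d) zero e =
    trans (Σwords-suc L _) (count-raney L d zero (afterDown-length L zero d e))
  count-raney (suc L) zero (suc n) e =
    trans (Σwords-suc L _) (trans (Σwords-cong L (λ w → +-identityʳ _))
      (count-raney L k n (afterUp-length L n zero e)))
  count-raney (suc L) (suc d) (suc n) e = begin
      count (suc L) (suc d) (suc n)
    ≡⟨ trans (Σwords-suc L _) (Σwords-+ L _ _) ⟩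
      count L (suc d + k) n + count L d (suc n)
    ≡⟨ cong₂ _+_ (count-raney L (suc d + k) n (afterUp-length L n (suc d) e))
                 (count-raney L d (suc n) (afterDown-length L (suc n) d e)) ⟩
      R (suc (suc d + k)) n + R (suc d) (suc n)
    ≡⟨ ℕP.+-comm (R (suc (suc d + k)) n) (R (suc d) (suc n)) ⟩
      R (suc (suc d)) (suc n)
    ∎
    where open ≡-Reasoning

  count-weighted : ∀ L d n c → L + t ≡ suc k * n + d →
    Σwords L (λ w → when (reachesAxis w d n) c) ≡ c * R (suc d) n
  count-weighted L d n c e =
    trans (Σwords-cong L (λ w → when-scale _ c)) (trans (Σwords-* L c _) (cong (c *_) (count-raney L d n e)))

  -- b(b-1): the second u-derivative of u^b at u = 1.
  falling₂ : ℕ → ℕ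
  falling₂ b = b * (b ∸ 1)

  falling₂-suc : ∀ j → falling₂ (suc j) ≡ falling₂ j + 2 * j
  falling₂-suc zero    = refl
  falling₂-suc (suc j) = expand j
    where
    expand : ∀ j → suc (suc j) * suc j ≡ suc j * j + 2 * suc j
    expand = solve-∀

  -- Walks reaching the axis, each weighted by falling₂ (j + b) where b is the number
  -- of its initial down-steps; j counts down-steps already taken.
  weighted : ℕ → ℕ → ℕ → ℕ → ℕ
  weighted L d n j = Σwords L (λ w → when (reachesAxis w d n) (falling₂ (j + initDowns w)))

  -- First-descent decomposition: the walk is D^b U followed by a walk counted by R;
  -- summing over b regroups into the tail sums Σ₁ and Σ₂.
  weighted-closed : ∀ L d m j → L + t ≡ suc k * suc m + d →
    weighted L d (suc m) j ≡ falling₂ j * R (suc d) (suc m) + 2 * j * Σ₁ m d + Σ₂ m d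
  weighted-closed zero d m j e = ⊥-elim (emptyWord-noUps m d e)
  weighted-closed (suc L) zero m j e = begin
      weighted (suc L) zero (suc m) j
    ≡⟨ trans (Σwords-suc L _) (Σwords-cong L (λ w → +-identityʳ _)) ⟩
      Σwords L (λ w → when (reachesAxis w k m) (falling₂ (j + 0)))
    ≡⟨ count-weighted L k m _ (afterUp-length L m zero e) ⟩
      falling₂ (j + 0) * R (suc k) m
    ≡⟨ cong (λ i → falling₂ i * R (suc k) m) (+-identityʳ j) ⟩
      falling₂ j * R (suc k) m
    ≡⟨ padZeros (falling₂ j * R (suc k) m) j ⟩
      falling₂ j * R (suc k) m + 2 * j * 0 + 0
    ∎
    where
    open ≡-Reasoning
    padZeros : ∀ x j → x ≡ x + 2 * j * 0 + 0
    padZeros = solve-∀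
  weighted-closed (suc L) (suc d) m j e = begin
      weighted (suc L) (suc d) (suc m) j
    ≡⟨ trans (Σwords-suc L _) (Σwords-+ L _ _) ⟩
      Σwords L (λ w → when (reachesAxis w (suc d + k) m) (falling₂ (j + 0)))
        + Σwords L (λ w → when (reachesAxis w d (suc m)) (falling₂ (j + suc (initDowns w))))
    ≡⟨ cong₂ _+_ (count-weighted L (suc d + k) m _ (afterUp-length L m (suc d) e))
                 (trans (Σwords-cong L (λ w → cong (λ i → when (reachesAxis w d (suc m)) (falling₂ i))
                                                    (+-suc j (initDowns w))))
                        (weighted-closed L d m (suc j) (afterDown-length L (suc m) d e))) ⟩
      falling₂ (j + 0) * x + (falling₂ (suc j) * r + 2 * suc j * s₁ + s₂)
    ≡⟨ cong₂ (λ a b → falling₂ a * x + (b * r + 2 * suc j * s₁ + s₂)) (+-identityʳ j) (falling₂-suc j) ⟩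
      falling₂ j * x + ((falling₂ j + 2 * j) * r + 2 * suc j * s₁ + s₂)
    ≡⟨ regroup (falling₂ j) j x r s₁ s₂ ⟩
      falling₂ j * (r + x) + 2 * j * (s₁ + r) + (s₂ + 2 * s₁)
    ∎
    where
    open ≡-Reasoning
    x = R (suc (suc d) + k) m
    r = R (suc d) (suc m)
    s₁ = Σ₁ m d
    s₂ = Σ₂ m d
    regroup : ∀ f j x r s₁ s₂ → f * x + ((f + 2 * j) * r + 2 * suc j * s₁ + s₂)
                                 ≡ f * (r + x) + 2 * j * (s₁ + r) + (s₂ + 2 * s₁)
    regroup = solve-∀

  coefficient : ∀ m → coeffD2S k t (suc m) ≡ Σ₂ m t
  coefficient m = begin
      coeffD2S k t (suc m)
    ≡⟨ sum-filter (λ w → isKtDyck k t w ∧ ⌊ ups w ℕP.≟ suc m ⌋) (λ w → falling₂ (initDowns w)) (allWords L) ⟩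
      Σwords L (λ w → when (isKtDyck k t w ∧ ⌊ ups w ℕP.≟ suc m ⌋) (falling₂ (initDowns w)))
    ≡⟨ Σwords-cong L (λ w → cong (λ b → when b (falling₂ (initDowns w))) (fromFloor w)) ⟩
      weighted L t (suc m) 0
    ≡⟨ weighted-closed L t m 0 refl ⟩
      Σ₂ m t
    ∎
    where
    open ≡-Reasoning
    L = suc k * suc m
    fromFloor : ∀ w → (isKtDyck k t w ∧ ⌊ ups w ℕP.≟ suc m ⌋) ≡ reachesAxis w t (suc m)
    fromFloor w = trans (cong (λ h → validFrom k t h w ∧ ⌊ ups w ℕP.≟ suc m ⌋) (sym (ℤP.+-inverseʳ (+ t))))
                        (validFrom-reachesAxis w t (suc m))

-- If L - R is an integer combination of differences lᵢ - rᵢ of equal integers, then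
-- L ≡ R.  This lets the ring solver check each step of the closed-form inductions.
module LinearCombination where
  open import Data.Integer using (ℤ; _+_; _-_; _*_)
  import Data.Integer.Properties as ℤP
  open import Relation.Binary.PropositionalEquality using (refl; trans; cong; cong₂)

  vanishes : ∀ c x → c * (x - x) ≡ + 0
  vanishes c x = trans (cong (c *_) (ℤP.+-inverseʳ x)) (ℤP.*-zeroʳ c)

  combine₂ : ∀ {L R l₁ r₁ l₂ r₂ : ℤ} c₁ c₂ → l₁ ≡ r₁ → l₂ ≡ r₂ →
    L - R ≡ c₁ * (l₁ - r₁) + c₂ * (l₂ - r₂) → L ≡ R
  combine₂ {L} {R} {l₁} {_} {l₂} c₁ c₂ refl refl e =
    ℤP.i-j≡0⇒i≡j L R (trans e (cong₂ _+_ (vanishes c₁ l₁) (vanishes c₂ l₂)))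

  combine₃ : ∀ {L R l₁ r₁ l₂ r₂ l₃ r₃ : ℤ} c₁ c₂ c₃ → l₁ ≡ r₁ → l₂ ≡ r₂ → l₃ ≡ r₃ →
    L - R ≡ c₁ * (l₁ - r₁) + c₂ * (l₂ - r₂) + c₃ * (l₃ - r₃) → L ≡ R
  combine₃ {L} {R} {l₁} {_} {l₂} {_} {l₃} c₁ c₂ c₃ refl refl refl e =
    ℤP.i-j≡0⇒i≡j L R (trans e (cong₂ _+_ (cong₂ _+_ (vanishes c₁ l₁) (vanishes c₂ l₂)) (vanishes c₃ l₃)))

  combine₄ : ∀ {L R l₁ r₁ l₂ r₂ l₃ r₃ l₄ r₄ : ℤ} c₁ c₂ c₃ c₄ →
    l₁ ≡ r₁ → l₂ ≡ r₂ → l₃ ≡ r₃ → l₄ ≡ r₄ →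
    L - R ≡ c₁ * (l₁ - r₁) + c₂ * (l₂ - r₂) + c₃ * (l₃ - r₃) + c₄ * (l₄ - r₄) → L ≡ R
  combine₄ {L} {R} {l₁} {_} {l₂} {_} {l₃} {_} {l₄} c₁ c₂ c₃ c₄ refl refl refl refl e =
    ℤP.i-j≡0⇒i≡j L R (trans e (cong₂ _+_ (cong₂ _+_ (cong₂ _+_ (vanishes c₁ l₁) (vanishes c₂ l₂))
                                                    (vanishes c₃ l₃)) (vanishes c₄ l₄)))

module ClosedForms (k m : ℕ) where
  open import Data.Nat as ℕ using (suc)
  import Data.Nat.Properties as ℕP
  open import Data.Nat.Combinatorics using (_C_)
  open import Data.Integer using (ℤ; -_; _+_; _-_; _*_)
  import Data.Integer.Properties as ℤP
  open import Relation.Binary.PropositionalEquality using (sym; trans; cong; cong₂; module ≡-Reasoning)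
  open import Data.Integer.Tactic.RingSolver using (solve-∀)
  open Binomial
  open RaneyNumbers k
  open LinearCombination

  N : ℕ
  N = suc k ℕ.* suc m

  n K : ℤ
  n = + suc m
  K = + k

  N-as-ℤ : + N ≡ (+ 1 + K) * n
  N-as-ℤ = ℤP.pos-* (suc k) (suc m)

  binom : ℕ → ℕ → ℤ
  binom x y = + (x C y)

  bin₊ bin₀ bin₋ : ℕ → ℤ
  bin₊ d = binom (N ℕ.+ d) (suc m ℕ.+ 1)
  bin₀ d = binom (N ℕ.+ d) (suc m)
  bin₋ d = binom (N ℕ.+ d) m

  base : ℤ
  base = binom N (suc m)

  raneyTerm : ℕ → ℤ
  raneyTerm d = + R (suc d) (suc m)

  n+1 : suc m ℕ.+ 1 ≡ suc (suc m)
  n+1 = ℕP.+-comm (suc m) 1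

  pascal₊ : ∀ d → bin₊ (suc d) ≡ bin₀ d + bin₊ d
  pascal₊ d = trans (cong₂ binom (ℕP.+-suc N d) n+1)
    (trans (cong +_ (pascal (N ℕ.+ d) (suc m))) (cong (λ j → bin₀ d + binom (N ℕ.+ d) j) (sym n+1)))

  pascal₀ : ∀ d → bin₀ (suc d) ≡ bin₋ d + bin₀ d
  pascal₀ d = trans (cong (λ x → binom x (suc m)) (ℕP.+-suc N d)) (cong +_ (pascal (N ℕ.+ d) m))

  pascal-base : bin₊ 1 ≡ base + bin₊ 0
  pascal-base = trans (cong₂ binom (ℕP.+-comm N 1) n+1)
    (trans (cong +_ (pascal N (suc m)))
      (cong₂ (λ x j → base + binom x j) (sym (ℕP.+-identityʳ N)) (sym n+1)))

  bin₀-zero : bin₀ 0 ≡ base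
  bin₀-zero = cong (λ x → binom x (suc m)) (ℕP.+-identityʳ N)

  absorptionℤ : ∀ x j → + suc j * binom (suc x) (suc j) ≡ + suc x * binom x j
  absorptionℤ x j =
    trans (sym (ℤP.pos-* (suc j) _)) (trans (cong +_ (absorption x j)) (ℤP.pos-* (suc x) _))

  absorption-base : (+ 1 + n) * bin₊ 1 ≡ (+ 1 + (+ 1 + K) * n) * base
  absorption-base = begin
      (+ 1 + n) * bin₊ 1
    ≡⟨ cong (λ x → (+ 1 + n) * binom x (suc m ℕ.+ 1)) (ℕP.+-comm N 1) ⟩
      (+ 1 + n) * binom (suc N) (suc m ℕ.+ 1)
    ≡⟨ cong (λ j → (+ 1 + n) * binom (suc N) j) n+1 ⟩
      (+ 1 + n) * binom (suc N) (suc (suc m))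
    ≡⟨ absorptionℤ N (suc m) ⟩
      (+ 1 + + N) * base
    ≡⟨ cong (λ z → (+ 1 + z) * base) N-as-ℤ ⟩
      (+ 1 + (+ 1 + K) * n) * base
    ∎
    where open ≡-Reasoning

  raneyℤ : ∀ d → (+ 1 + + d + (+ 1 + K) * n) * raneyTerm d ≡ (+ 1 + + d) * bin₀ (suc d)
  raneyℤ d = begin
      (+ 1 + + d + (+ 1 + K) * n) * raneyTerm d
    ≡⟨ cong (λ z → (+ 1 + + d + z) * raneyTerm d) (sym N-as-ℤ) ⟩
      + (suc d ℕ.+ N) * raneyTerm d
    ≡⟨ sym (ℤP.pos-* (suc d ℕ.+ N) (R (suc d) (suc m))) ⟩
      + ((suc d ℕ.+ N) ℕ.* R (suc d) (suc m))
    ≡⟨ cong +_ (raney (suc d) (suc m)) ⟩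
      + (suc d ℕ.* ((suc d ℕ.+ N) C suc m))
    ≡⟨ ℤP.pos-* (suc d) ((suc d ℕ.+ N) C suc m) ⟩
      (+ 1 + + d) * binom (suc d ℕ.+ N) (suc m)
    ≡⟨ cong (λ x → (+ 1 + + d) * binom x (suc m)) (ℕP.+-comm (suc d) N) ⟩
      (+ 1 + + d) * bin₀ (suc d)
    ∎
    where open ≡-Reasoning

  absorption₀ : ∀ d → n * bin₀ (suc d) ≡ (+ 1 + + d + (+ 1 + K) * n) * bin₋ d
  absorption₀ d = begin
      n * bin₀ (suc d)
    ≡⟨ cong (λ x → n * binom x (suc m)) (ℕP.+-suc N d) ⟩
      n * binom (suc (N ℕ.+ d)) (suc m)
    ≡⟨ absorptionℤ (N ℕ.+ d) m ⟩
      + suc (N ℕ.+ d) * bin₋ d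
    ≡⟨ cong (λ x → + suc x * bin₋ d) (ℕP.+-comm N d) ⟩
      + suc (d ℕ.+ N) * bin₋ d
    ≡⟨ cong (λ z → (+ 1 + + d + z) * bin₋ d) N-as-ℤ ⟩
      (+ 1 + + d + (+ 1 + K) * n) * bin₋ d
    ∎
    where open ≡-Reasoning

  raney-shift : ∀ d → (+ 2 + n) * raneyTerm d ≡ + 2 * bin₀ (suc d) + (+ d - + 2 * K - + 1) * bin₋ d
  raney-shift d = ℤP.*-cancelˡ-≡ (+ suc (d ℕ.+ N)) _ _ (trans (cong (_* ((+ 2 + n) * raneyTerm d)) eM)
    (trans (combine₂ (+ 2 + n) (+ d - + 2 * K - + 1) (raneyℤ d) (absorption₀ d)
                     (identity n K (+ d) (raneyTerm d) (bin₀ (suc d)) (bin₋ d)))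
           (cong (_* (+ 2 * bin₀ (suc d) + (+ d - + 2 * K - + 1) * bin₋ d)) (sym eM))))
    where
    eM : + suc (d ℕ.+ N) ≡ + 1 + + d + (+ 1 + K) * n
    eM = cong (λ z → + 1 + + d + z) N-as-ℤ
    identity : ∀ n k t r a c →
      (+ 1 + t + (+ 1 + k) * n) * ((+ 2 + n) * r) - (+ 1 + t + (+ 1 + k) * n) * (+ 2 * a + (t - + 2 * k - + 1) * c)
        ≡ (+ 2 + n) * ((+ 1 + t + (+ 1 + k) * n) * r - (+ 1 + t) * a)
          + (t - + 2 * k - + 1) * (n * a - (+ 1 + t + (+ 1 + k) * n) * c)
    identity = solve-∀

  closed₁ : ℕ → ℤ
  closed₁ d = (+ 1 + n) * (bin₊ (suc d) + (+ d - + 2 * K - + 1) * bin₀ d) + (+ 2 + n) * K * base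

  Σ₁-closed : ∀ d → (+ 1 + n) * (+ 2 + n) * + Σ₁ m d ≡ closed₁ d
  Σ₁-closed ℕ.zero = combine₂ (- + 1) ((+ 1 + n) * (+ 2 * K + + 1)) absorption-base bin₀-zero
      (identity n K (bin₊ 1) (bin₀ 0) base)
    where
    identity : ∀ n k A₁ a₀ B →
      (+ 1 + n) * (+ 2 + n) * + 0 - ((+ 1 + n) * (A₁ + (+ 0 - + 2 * k - + 1) * a₀) + (+ 2 + n) * k * B)
        ≡ - + 1 * ((+ 1 + n) * A₁ - (+ 1 + (+ 1 + k) * n) * B) + (+ 1 + n) * (+ 2 * k + + 1) * (a₀ - B)
    identity = solve-∀
  Σ₁-closed (suc d) =
    combine₄ (+ 1) (+ 1 + n) (- (+ 1 + n)) (- ((+ 1 + n) * (+ d - + 2 * K - + 1)))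
      (Σ₁-closed d) (raney-shift d) (pascal₊ (suc d)) (pascal₀ d)
      (identity n K (+ d) (+ Σ₁ m d) (raneyTerm d) (bin₊ (suc (suc d))) (bin₊ (suc d))
                (bin₀ (suc d)) (bin₀ d) (bin₋ d) base)
    where
    identity : ∀ n k t S r A₂ A₁ a₁ a₀ c B →
      (+ 1 + n) * (+ 2 + n) * (S + r) - ((+ 1 + n) * (A₂ + (+ 1 + t - + 2 * k - + 1) * a₁) + (+ 2 + n) * k * B)
        ≡ + 1 * ((+ 1 + n) * (+ 2 + n) * S - ((+ 1 + n) * (A₁ + (t - + 2 * k - + 1) * a₀) + (+ 2 + n) * k * B))
          + (+ 1 + n) * ((+ 2 + n) * r - (+ 2 * a₁ + (t - + 2 * k - + 1) * c))
          + - (+ 1 + n) * (A₂ - (a₁ + A₁))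
          + - ((+ 1 + n) * (t - + 2 * k - + 1)) * (a₁ - (c + a₀))
    identity = solve-∀

  -- The closed form of (n+1)(n+2) Σ₂ m d: at d = t it is the theorem times (n+1)(n+2).
  closed₂ : ℕ → ℤ
  closed₂ d = + 2 * (+ d - + 2 * K - + 1) * (+ 1 + n) * bin₊ d
              + + 2 * (+ d - + 1) * K * (+ 2 + n) * base + + 4 * K * (+ 1 + n) * bin₊ 1

  Σ₂-closed : ∀ d → (+ 1 + n) * (+ 2 + n) * + Σ₂ m d ≡ closed₂ d
  Σ₂-closed ℕ.zero = combine₂ (- (+ 2 * (+ 1 + n) * (+ 2 * K + + 1))) (+ 2) pascal-base absorption-base
      (identity n K (bin₊ 1) (bin₊ 0) base)
    where
    identity : ∀ n k A₁ A₀ B →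
      (+ 1 + n) * (+ 2 + n) * + 0
        - (+ 2 * (+ 0 - + 2 * k - + 1) * (+ 1 + n) * A₀ + + 2 * (+ 0 - + 1) * k * (+ 2 + n) * B
           + + 4 * k * (+ 1 + n) * A₁)
        ≡ - (+ 2 * (+ 1 + n) * (+ 2 * k + + 1)) * (A₁ - (B + A₀))
          + + 2 * ((+ 1 + n) * A₁ - (+ 1 + (+ 1 + k) * n) * B)
    identity = solve-∀
  Σ₂-closed (suc d) =
    combine₃ (+ 1) (+ 2) (+ 2 * (+ 1 + n) * (+ 2 * K + + 1 - + d)) (Σ₂-closed d) (Σ₁-closed d) (pascal₊ d)
      (trans (cong (λ z → (+ 1 + n) * (+ 2 + n) * (+ Σ₂ m d + z) - closed₂ (suc d)) (ℤP.pos-* 2 (Σ₁ m d)))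
             (identity n K (+ d) (+ Σ₂ m d) (+ Σ₁ m d) (bin₊ (suc d)) (bin₊ d) (bin₀ d) base (bin₊ 1)))
    where
    identity : ∀ n k t S s A₁ A₀ a₀ B C →
      (+ 1 + n) * (+ 2 + n) * (S + + 2 * s)
        - (+ 2 * (+ 1 + t - + 2 * k - + 1) * (+ 1 + n) * A₁ + + 2 * (+ 1 + t - + 1) * k * (+ 2 + n) * B
           + + 4 * k * (+ 1 + n) * C)
        ≡ + 1 * ((+ 1 + n) * (+ 2 + n) * S
                 - (+ 2 * (t - + 2 * k - + 1) * (+ 1 + n) * A₀ + + 2 * (t - + 1) * k * (+ 2 + n) * B
                    + + 4 * k * (+ 1 + n) * C))
          + + 2 * ((+ 1 + n) * (+ 2 + n) * s - ((+ 1 + n) * (A₁ + (t - + 2 * k - + 1) * a₀) + (+ 2 + n) * k * B))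
          + + 2 * (+ 1 + n) * (+ 2 * k + + 1 - t) * (A₁ - (a₀ + A₀))
    identity = solve-∀

module ClearingDenominators where
  open import Data.Nat using (suc)
  open import Data.Integer using (ℤ; _+_; _*_)
  import Data.Integer.Properties as ℤP
  import Data.Rational as ℚ
  import Data.Rational.Properties as ℚP
  open import Data.Rational.Unnormalised as ℚᵘ using (mkℚᵘ; *≡*; ↥_; ↧_)
  import Data.Rational.Unnormalised.Properties as ℚᵘP
  open import Relation.Binary.PropositionalEquality using (refl; sym; trans; cong; cong₂; module ≡-Reasoning)
  open import Data.Integer.Tactic.RingSolver using (solve-∀)

  ↥-+ : ∀ p q → ↥ (p ℚᵘ.+ q) ≡ ↥ p * ↧ q + ↥ q * ↧ p
  ↥-+ (mkℚᵘ _ _) (mkℚᵘ _ _) = refl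

  ↧-+ : ∀ p q → ↧ (p ℚᵘ.+ q) ≡ ↧ p * ↧ q
  ↧-+ (mkℚᵘ _ a) (mkℚᵘ _ b) = ℤP.pos-* (suc a) (suc b)

  ↥-* : ∀ p q → ↥ (p ℚᵘ.* q) ≡ ↥ p * ↥ q
  ↥-* (mkℚᵘ _ _) (mkℚᵘ _ _) = refl

  ↧-* : ∀ p q → ↧ (p ℚᵘ.* q) ≡ ↧ p * ↧ q
  ↧-* (mkℚᵘ _ a) (mkℚᵘ _ b) = ℤP.pos-* (suc a) (suc b)

  toℚᵘ-/ : ∀ z d → ℚ.toℚᵘ (z / suc d) ℚᵘ.≃ mkℚᵘ z d
  toℚᵘ-/ z d = ℚP.toℚᵘ-fromℚᵘ (mkℚᵘ z d)

  toℚᵘ-term : ∀ z d A → ℚ.toℚᵘ ((z / suc d) ℚ.* (A / 1)) ℚᵘ.≃ mkℚᵘ z d ℚᵘ.* mkℚᵘ A 0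
  toℚᵘ-term z d A = ℚᵘP.≃-trans (ℚP.toℚᵘ-homo-* (z / suc d) (A / 1)) (ℚᵘP.*-cong (toℚᵘ-/ z d) (toℚᵘ-/ A 0))

  clearDenominators : ∀ (X z₁ z₂ z₃ A B C : ℤ) n →
    + suc n * + suc (suc n) * X ≡ z₁ * + suc n * A + z₂ * + suc (suc n) * B + z₃ * + suc n * C →
    X / 1 ≡ (z₁ / suc (suc n)) ℚ.* (A / 1) ℚ.+ (z₂ / suc n) ℚ.* (B / 1) ℚ.+ (z₃ / suc (suc n)) ℚ.* (C / 1)
  clearDenominators X z₁ z₂ z₃ A B C n identity =
    ℚP.toℚᵘ-injective (ℚᵘP.≃-trans (toℚᵘ-/ X 0) (ℚᵘP.≃-trans (*≡* crossMultiplied) (ℚᵘP.≃-sym homomorphic)))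
    where
    d₁ d₂ : ℤ
    d₁ = + suc n
    d₂ = + suc (suc n)
    P₁ = mkℚᵘ z₁ (suc n) ℚᵘ.* mkℚᵘ A 0
    P₂ = mkℚᵘ z₂ n ℚᵘ.* mkℚᵘ B 0
    P₃ = mkℚᵘ z₃ (suc n) ℚᵘ.* mkℚᵘ C 0
    E = P₁ ℚᵘ.+ P₂ ℚᵘ.+ P₃

    Q₁ = (z₁ / suc (suc n)) ℚ.* (A / 1)
    Q₂ = (z₂ / suc n) ℚ.* (B / 1)
    Q₃ = (z₃ / suc (suc n)) ℚ.* (C / 1)

    homomorphic : ℚ.toℚᵘ (Q₁ ℚ.+ Q₂ ℚ.+ Q₃) ℚᵘ.≃ E
    homomorphic = ℚᵘP.≃-trans (ℚP.toℚᵘ-homo-+ (Q₁ ℚ.+ Q₂) Q₃)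
      (ℚᵘP.+-cong (ℚᵘP.≃-trans (ℚP.toℚᵘ-homo-+ Q₁ Q₂) (ℚᵘP.+-cong (toℚᵘ-term z₁ (suc n) A) (toℚᵘ-term z₂ n B)))
                  (toℚᵘ-term z₃ (suc n) C))

    ↧P₁ : ↧ P₁ ≡ d₂ * + 1
    ↧P₁ = ↧-* (mkℚᵘ z₁ (suc n)) (mkℚᵘ A 0)
    ↧P₂ : ↧ P₂ ≡ d₁ * + 1
    ↧P₂ = ↧-* (mkℚᵘ z₂ n) (mkℚᵘ B 0)
    ↧P₃ : ↧ P₃ ≡ d₂ * + 1
    ↧P₃ = ↧-* (mkℚᵘ z₃ (suc n)) (mkℚᵘ C 0)
    ↧P₁₂ : ↧ (P₁ ℚᵘ.+ P₂) ≡ (d₂ * + 1) * (d₁ * + 1)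
    ↧P₁₂ = trans (↧-+ P₁ P₂) (cong₂ _*_ ↧P₁ ↧P₂)

    ↥E : ↥ E ≡ (z₁ * A * (d₁ * + 1) + z₂ * B * (d₂ * + 1)) * (d₂ * + 1) + z₃ * C * ((d₂ * + 1) * (d₁ * + 1))
    ↥E = begin
        ↥ E
      ≡⟨ ↥-+ (P₁ ℚᵘ.+ P₂) P₃ ⟩
        ↥ (P₁ ℚᵘ.+ P₂) * ↧ P₃ + ↥ P₃ * ↧ (P₁ ℚᵘ.+ P₂)
      ≡⟨ cong (λ x → x * ↧ P₃ + ↥ P₃ * ↧ (P₁ ℚᵘ.+ P₂)) (↥-+ P₁ P₂) ⟩
        (z₁ * A * ↧ P₂ + z₂ * B * ↧ P₁) * ↧ P₃ + z₃ * C * ↧ (P₁ ℚᵘ.+ P₂)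
      ≡⟨ cong₂ (λ x y → (z₁ * A * x + z₂ * B * y) * ↧ P₃ + z₃ * C * ↧ (P₁ ℚᵘ.+ P₂)) ↧P₂ ↧P₁ ⟩
        (z₁ * A * (d₁ * + 1) + z₂ * B * (d₂ * + 1)) * ↧ P₃ + z₃ * C * ↧ (P₁ ℚᵘ.+ P₂)
      ≡⟨ cong₂ (λ x y → (z₁ * A * (d₁ * + 1) + z₂ * B * (d₂ * + 1)) * x + z₃ * C * y) ↧P₃ ↧P₁₂ ⟩
        (z₁ * A * (d₁ * + 1) + z₂ * B * (d₂ * + 1)) * (d₂ * + 1) + z₃ * C * ((d₂ * + 1) * (d₁ * + 1))
      ∎
      where open ≡-Reasoning

    ↧E : ↧ E ≡ ((d₂ * + 1) * (d₁ * + 1)) * (d₂ * + 1)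
    ↧E = trans (↧-+ (P₁ ℚᵘ.+ P₂) P₃) (cong₂ _*_ ↧P₁₂ ↧P₃)

    crossMultiplied : X * ↧ E ≡ ↥ E * + 1
    crossMultiplied = begin
        X * ↧ E
      ≡⟨ cong (X *_) ↧E ⟩
        X * (((d₂ * + 1) * (d₁ * + 1)) * (d₂ * + 1))
      ≡⟨ factor X d₁ d₂ ⟩
        d₂ * (d₁ * d₂ * X)
      ≡⟨ cong (d₂ *_) identity ⟩
        d₂ * (z₁ * d₁ * A + z₂ * d₂ * B + z₃ * d₁ * C)
      ≡⟨ expand z₁ z₂ z₃ A B C d₁ d₂ ⟩
        ((z₁ * A * (d₁ * + 1) + z₂ * B * (d₂ * + 1)) * (d₂ * + 1) + z₃ * C * ((d₂ * + 1) * (d₁ * + 1))) * + 1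
      ≡⟨ cong (_* + 1) (sym ↥E) ⟩
        ↥ E * + 1
      ∎
      where
      open ≡-Reasoning
      factor : ∀ X d₁ d₂ → X * (((d₂ * + 1) * (d₁ * + 1)) * (d₂ * + 1)) ≡ d₂ * (d₁ * d₂ * X)
      factor = solve-∀
      expand : ∀ z₁ z₂ z₃ A B C d₁ d₂ →
        d₂ * (z₁ * d₁ * A + z₂ * d₂ * B + z₃ * d₁ * C)
          ≡ ((z₁ * A * (d₁ * + 1) + z₂ * B * (d₂ * + 1)) * (d₂ * + 1) + z₃ * C * ((d₂ * + 1) * (d₁ * + 1))) * + 1
      expand = solve-∀

open import Data.Nat using (zero; suc)
import Data.Nat as ℕ
import Data.Integer as ℤ
import Data.Integer.Properties as ℤP
open import Relation.Binary.PropositionalEquality using (sym; trans; cong; cong₂; module ≡-Reasoning)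
open RaneyNumbers using (Σ₂)
open ClearingDenominators using (clearDenominators)

proposition5p6 : (k t n : ℕ) → 1 ≤ k → t ≤ k → 1 ≤ n →
    (+ coeffD2S k t n) / 1 ≡ rhs k t n
proposition5p6 k t zero _ _ ()
proposition5p6 k t (suc m) _ t≤k _ = begin
    + coeffD2S k t (suc m) / 1
  ≡⟨ cong (λ c → + c / 1) (Counting.coefficient k t t≤k m) ⟩
    + Σ₂ k m t / 1
  ≡⟨ clearDenominators (+ Σ₂ k m t) z₁ z₂ z₃ (bin₊ t) base (bin₊ 1) (suc m) (trans (Σ₂-closed t) rhsShape) ⟩
    rhs k t (suc m)
  ∎
  where
  open ≡-Reasoning
  open ClosedForms k m using (n; K; bin₊; base; closed₂; Σ₂-closed)
  z₁ z₂ z₃ : ℤ.ℤ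
  z₁ = + 2 ℤ.* (+ t ℤ.- + (2 ℕ.* k) ℤ.- + 1)
  z₂ = + 2 ℤ.* (+ t ℤ.- + 1) ℤ.* K
  z₃ = + (4 ℕ.* k)
  -- The closed form with 2k and 4k written as in the statement.
  rhsShape : closed₂ t ≡ z₁ ℤ.* (+ 1 ℤ.+ n) ℤ.* bin₊ t ℤ.+ z₂ ℤ.* (+ 2 ℤ.+ n) ℤ.* base
                         ℤ.+ z₃ ℤ.* (+ 1 ℤ.+ n) ℤ.* bin₊ 1
  rhsShape = cong₂ (λ a b → + 2 ℤ.* (+ t ℤ.- a ℤ.- + 1) ℤ.* (+ 1 ℤ.+ n) ℤ.* bin₊ t
                            ℤ.+ + 2 ℤ.* (+ t ℤ.- + 1) ℤ.* K ℤ.* (+ 2 ℤ.+ n) ℤ.* base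
                            ℤ.+ b ℤ.* (+ 1 ℤ.+ n) ℤ.* bin₊ 1)
                   (sym (ℤP.pos-* 2 k)) (sym (ℤP.pos-* 4 k))
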